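{- For every simple graph $G$ of order $n\ge2$ and every positive integer $t$, $\chi\big(S[G,t]\big)\le \chi(G)+1$.
   Context: Let $G$ be a simple graph with vertex set $V=\{1,\dots,n\}$, $n\ge 2$. For $t\ge 1$, the generalized Sierpiński graph $S(G,t)$ has vertex set $V^t$ (words $u_1u_2\cdots u_t$ over $V$), and two words ${\bf u}=u_1\cdots u_t$, ${\bf v}=v_1\cdots v_t$ are adjacent iff there is $i\in\{1,\dots,t\}$ with $u_j=v_j$ for $j<i$, $u_i\neq v_i$ and $u_iv_i\in E(G)$, and $u_j=v_i$, $v_j=u_i$ for all $j>i$. An edge of this kind with $i<t$ is called a linking edge. The generalized Sierpiński gasket $S[G,t]$ is the graph obtained from $S(G,t)$ by contracting all linking edges (so $S[G,1]=G$). $\chi$ denotes chromatic number. -}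

module Defs where

open import Level using (0ℓ)
open import Data.Nat using (ℕ; suc; _≤_; _<_)
open import Data.Fin using (Fin; toℕ)
open import Data.Vec using (Vec; lookup)
open import Data.Product using (Σ; _×_)
open import Relation.Nullary using (¬_)
open import Relation.Binary.PropositionalEquality using (_≡_; _≢_)
open import Relation.Binary.Construct.Closure.Equivalence using (EqClosure)

-- A simple graph on the vertex set V = Fin n (vertices 1..n rendered as 0..n-1):
-- an irreflexive symmetric adjacency relation.
record Graph (n : ℕ) : Set₁ where
  field
    Adj   : Fin n → Fin n → Set
    sym   : ∀ {x y} → Adj x y → Adj y x
    irrfl : ∀ {x} → ¬ Adj x x
open Graph public

IsProperColouring : ∀ {n} (G : Graph n) {k : ℕ} → (Fin n → Fin k) → Set
IsProperColouring G c = ∀ x y → Adj G x y → c x ≢ c y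

Colourable : ∀ {n} → Graph n → ℕ → Set
Colourable {n} G k = Σ (Fin n → Fin k) (IsProperColouring G)

IsChromaticNumber : ∀ {n} → Graph n → ℕ → Set
IsChromaticNumber G k = Colourable G k × (∀ m → Colourable G m → k ≤ m)

Word : ℕ → ℕ → Set
Word n t = Vec (Fin n) t

-- Edge of S(G,t) "at position i" between words u and v
-- (positions 1..t rendered as Fin t, i.e. 0..t-1).
SEdgeAt : ∀ {n t} → Graph n → Fin t → Word n t → Word n t → Set
SEdgeAt G i u v =
    (∀ j → toℕ j < toℕ i → lookup u j ≡ lookup v j)
  × lookup u i ≢ lookup v i
  × Adj G (lookup u i) (lookup v i)
  × (∀ j → toℕ i < toℕ j → (lookup u j ≡ lookup v i) × (lookup v j ≡ lookup u i))

SAdj : ∀ {n t} → Graph n → Word n t → Word n t → Set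
SAdj {t = t} G u v = Σ (Fin t) λ i → SEdgeAt G i u v

-- Linking edge: an edge at position i < t (0-based: toℕ i + 1 < t).
LinkingEdge : ∀ {n t} → Graph n → Word n t → Word n t → Set
LinkingEdge {t = t} G u v = Σ (Fin t) λ i → (suc (toℕ i) < t) × SEdgeAt G i u v

-- Contracting all linking edges identifies words in the same class of the
-- equivalence relation generated by linking edges.
Contracted : ∀ {n t} → Graph n → Word n t → Word n t → Set
Contracted G = EqClosure (LinkingEdge G)

-- S[G,t]: vertices are the ≈-classes (Contracted); two distinct classes are
-- adjacent iff some representatives are adjacent in S(G,t).
GasketAdj : ∀ {n t} → Graph n → Word n t → Word n t → Set
GasketAdj G u v = SAdj G u v × ¬ Contracted G u v

-- A proper k-colouring of S[G,t] is a colouring of the classes, i.e. a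
-- colouring of words constant on classes, proper on adjacent classes.
GasketColourable : ∀ {n} → Graph n → (t k : ℕ) → Set
GasketColourable {n} G t k =
  Σ (Word n t → Fin k) λ c →
      (∀ u v → Contracted G u v → c u ≡ c v)
    × (∀ u v → GasketAdj G u v → c u ≢ c v)

IsGasketChromaticNumber : ∀ {n} → Graph n → ℕ → ℕ → Set
IsGasketChromaticNumber G t k =
  GasketColourable G t k × (∀ m → GasketColourable G t m → k ≤ m)

module Submission where

open import Defs
open import Data.Nat using (ℕ; _≤_; _+_; zero; suc; _*_; _∸_; _<_; _<?_; _%_; _/_; z≤n; s≤s; NonZero)
open import Data.Nat.Properties
  using ( ≤-trans; ≤-antisym; m≤m+n; ≮⇒≥; <⇒≤; suc-injective; m∸n+n≡m
        ; +-assoc; +-comm; +-identityʳ; *-identityˡ; *-distribʳ-+)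
open import Data.Nat.DivMod
  using (_mod_; m≡m%n+[m/n]*n; m%n<n; [m+n]%n≡m%n; [m+kn]%n≡m%n; m<n⇒m%n≡m; %-distribˡ-+)
open import Data.Nat.Solver using (module +-*-Solver)
open import Data.Fin using (Fin; toℕ) renaming (zero to fzero; suc to fsuc)
open import Data.Fin.Properties using (toℕ-injective; toℕ-fromℕ<; toℕ<n)
open import Data.Vec using ([]; _∷_; lookup)
open import Data.Product using (Σ; _×_; _,_; proj₁; proj₂)
open import Relation.Nullary using (yes; no)
open import Relation.Binary.PropositionalEquality
  using (_≡_; _≢_; refl; cong; trans; module ≡-Reasoning)
  renaming (sym to ≡-sym; isEquivalence to ≡-isEquivalence)
open import Relation.Binary.Construct.Closure.Equivalence using (gfold; return)

-- Give the letter of a word followed by m further letters the weight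
-- weight m (1, 1, 2, 4, … from the right), and colour a word by the weighted
-- sum of the G-colours of its letters, mod k.  Every weight except the last
-- equals the sum of the weights after it, so the potential of p a bʳ equals
-- that of p b aʳ: a linking edge does not change the colour.  The remaining
-- edges of S(G,t) change only the last letter, from a to some b adjacent to
-- a in G, so they change the colour by c b − c a ≢ 0 (mod k).

weight weightSum : ℕ → ℕ
weight zero    = 1
weight (suc m) = weightSum (suc m)
weightSum zero    = 0
weightSum (suc m) = weight m + weightSum m

AgreeBefore : ∀ {n t} → Fin t → Word n t → Word n t → Set
AgreeBefore i u v = ∀ j → toℕ j < toℕ i → lookup u j ≡ lookup v j

SwappedAfter : ∀ {n t} → Fin t → Word n t → Word n t → Set
SwappedAfter i u v =
  ∀ j → toℕ i < toℕ j → (lookup u j ≡ lookup v i) × (lookup v j ≡ lookup u i)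

+-%-cancelˡ : ∀ {k} .{{_ : NonZero k}} m {a} → a < k → (k ∸ m % k + (m + a)) % k ≡ a
+-%-cancelˡ {k} m {a} a<k = begin
  (s + (m + a)) % k             ≡⟨ cong (λ x → (s + (x + a)) % k) (m≡m%n+[m/n]*n m k) ⟩
  (s + ((r + q * k) + a)) % k   ≡⟨ cong (_% k) (rearrange s r (q * k) a) ⟩
  ((a + q * k) + (s + r)) % k   ≡⟨ cong (λ x → ((a + q * k) + x) % k) (m∸n+n≡m (<⇒≤ (m%n<n m k))) ⟩
  ((a + q * k) + k) % k         ≡⟨ [m+n]%n≡m%n (a + q * k) k ⟩
  (a + q * k) % k               ≡⟨ [m+kn]%n≡m%n a q k ⟩
  a % k                         ≡⟨ m<n⇒m%n≡m a<k ⟩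
  a                             ∎
  where
  open ≡-Reasoning
  open +-*-Solver
  r = m % k
  q = m / k
  s = k ∸ r
  rearrange : ∀ s r x a → s + ((r + x) + a) ≡ (a + x) + (s + r)
  rearrange = solve 4 (λ s r x a → s :+ ((r :+ x) :+ a) := (a :+ x) :+ (s :+ r)) refl

+-%-injectiveʳ : ∀ {k} .{{_ : NonZero k}} m {a b} → a < k → b < k →
                 (m + a) % k ≡ (m + b) % k → a ≡ b
+-%-injectiveʳ {k} m {a} {b} a<k b<k eq = begin
  a                                     ≡⟨ ≡-sym (+-%-cancelˡ m a<k) ⟩
  (s + (m + a)) % k                     ≡⟨ %-distribˡ-+ s (m + a) k ⟩
  (s % k + (m + a) % k) % k             ≡⟨ cong (λ x → (s % k + x) % k) eq ⟩
  (s % k + (m + b) % k) % k             ≡⟨ ≡-sym (%-distribˡ-+ s (m + b) k) ⟩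
  (s + (m + b)) % k                     ≡⟨ +-%-cancelˡ m b<k ⟩
  b                                     ∎
  where
  open ≡-Reasoning
  s = k ∸ m % k

module Potential {n k : ℕ} (c : Fin n → Fin k) where

  potential : ∀ {m} → Word n m → ℕ
  potential []            = 0
  potential {suc m} (x ∷ u) = weight m * toℕ (c x) + potential u

  potential-constant : ∀ {m} (u : Word n m) b → (∀ j → lookup u j ≡ b) →
                       potential u ≡ weightSum m * toℕ (c b)
  potential-constant []            b u≡b = refl
  potential-constant {suc m} (x ∷ u) b u≡b
    rewrite u≡b fzero | potential-constant u b (λ j → u≡b (fsuc j)) =
    ≡-sym (*-distribʳ-+ (toℕ (c b)) (weight m) (weightSum m))

  potential-swap : ∀ {m} (i : Fin m) (u v : Word n m) → suc (toℕ i) < m →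
                   AgreeBefore i u v → SwappedAfter i u v → potential u ≡ potential v
  potential-swap {suc (suc m)} fzero (a ∷ u) (b ∷ v) _ _ swapped
    rewrite potential-constant u b (λ j → proj₁ (swapped (fsuc j) (s≤s z≤n)))
          | potential-constant v a (λ j → proj₂ (swapped (fsuc j) (s≤s z≤n))) =
    +-comm (weightSum (suc m) * toℕ (c a)) (weightSum (suc m) * toℕ (c b))
  potential-swap {suc m} (fsuc i) (x ∷ u) (y ∷ v) (s≤s i<m) agree swapped
    rewrite agree fzero (s≤s z≤n) =
    cong (weight m * toℕ (c y) +_)
      (potential-swap i u v i<m (λ j j<i → agree (fsuc j) (s≤s j<i))
                                (λ j i<j → swapped (fsuc j) (s≤s i<j)))

  potential-lastLetter : ∀ {m} (i : Fin m) (u v : Word n m) → suc (toℕ i) ≡ m →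
    AgreeBefore i u v →
    Σ ℕ λ p → (potential u ≡ p + toℕ (c (lookup u i))) × (potential v ≡ p + toℕ (c (lookup v i)))
  potential-lastLetter fzero (a ∷ []) (b ∷ []) _ _ =
    0 , trans (+-identityʳ _) (*-identityˡ _) , trans (+-identityʳ _) (*-identityˡ _)
  potential-lastLetter {suc m} (fsuc i) (x ∷ u) (y ∷ v) i-last agree
    rewrite agree fzero (s≤s z≤n)
    with potential-lastLetter i u v (suc-injective i-last) (λ j j<i → agree (fsuc j) (s≤s j<i))
  ... | p , pu , pv = weight m * toℕ (c y) + p , shift pu , shift pv
    where
    shift : ∀ {x d} → x ≡ p + d → weight m * toℕ (c y) + x ≡ (weight m * toℕ (c y) + p) + d
    shift {x} {d} x≡p+d = trans (cong (weight m * toℕ (c y) +_) x≡p+d) (≡-sym (+-assoc _ p d))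

gasketColourable : ∀ {n} (G : Graph n) t {k} .{{_ : NonZero k}} →
                   Colourable G k → GasketColourable G t k
gasketColourable G t {k} (c , proper) = colour , colour-contracted , colour-proper
  where
  open Potential c

  colour : Word _ t → Fin k
  colour u = potential u mod k

  colour-contracted : ∀ u v → Contracted G u v → colour u ≡ colour v
  colour-contracted u v u≈v = cong (_mod k) (gfold ≡-isEquivalence potential (λ {u} {v} → linking {u} {v}) u≈v)
    where
    linking : ∀ {u v} → LinkingEdge G u v → potential u ≡ potential v
    linking {u} {v} (i , i<last , agree , _ , _ , swapped) = potential-swap i u v i<last agree swapped

  colour-proper : ∀ u v → GasketAdj G u v → colour u ≢ colour v
  colour-proper u v ((i , edge@(agree , _ , adj , _)) , uncontracted) same
    with suc (toℕ i) <? t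
  ... | yes i<last = uncontracted (return (i , i<last , edge))
  ... | no  i≮last with potential-lastLetter i u v (≤-antisym (toℕ<n i) (≮⇒≥ i≮last)) agree
  ...   | p , pu , pv = proper _ _ adj (toℕ-injective (+-%-injectiveʳ p (toℕ<n _) (toℕ<n _) (begin
    (p + toℕ (c (lookup u i))) % k  ≡⟨ cong (_% k) (≡-sym pu) ⟩
    potential u % k                 ≡⟨ ≡-sym (toℕ-fromℕ< _) ⟩
    toℕ (colour u)                  ≡⟨ cong toℕ same ⟩
    toℕ (colour v)                  ≡⟨ toℕ-fromℕ< _ ⟩
    potential v % k                 ≡⟨ cong (_% k) pv ⟩
    (p + toℕ (c (lookup v i))) % k  ∎)))
    where open ≡-Reasoning

mainTheorem3 : ∀ (n : ℕ) → 2 ≤ n → (G : Graph n) → ∀ (t : ℕ) → 1 ≤ t →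
    ∀ (χG χS : ℕ) → IsChromaticNumber G χG → IsGasketChromaticNumber G t χS →
    χS ≤ χG + 1
mainTheorem3 (suc _) _ G t _ zero _ ((c , _) , _) _ with c fzero
... | ()
mainTheorem3 (suc _) _ G t _ (suc k) χS (colourable , _) (_ , χS-minimal) =
  ≤-trans (χS-minimal (suc k) (gasketColourable G t colourable)) (m≤m+n (suc k) 1)
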